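{- Let $n\geq 3$ be an integer. If $S_i(n)\neq\emptyset$, then $i\leq 2+\log_2\binom{n}{2}$.
   Context: $\sigma_k$ denotes the $k$-th elementary symmetric polynomial in $n$ variables. $S(n)$ is the set of $n$-tuples $(x_1,\ldots,x_n)$ of positive integers with $x_1\leq\cdots\leq x_n$ and $\sigma_2(x_1,\ldots,x_n)=\sigma_n(x_1,\ldots,x_n)$. For $i\in\{0,\ldots,n\}$, $S_i(n)$ is the set of $(x_1,\ldots,x_n)\in S(n)$ with $x_1=\cdots=x_{n-i}=1$ and $2\leq x_{n-i+1}\leq\cdots\leq x_n$. -}

module Defs where

open import Data.Nat using (ℕ; zero; suc; _+_; _*_; _∸_; _≤_; _<_)
open import Data.Vec using (Vec; []; _∷_; lookup)
open import Data.Fin using (Fin; toℕ)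
open import Relation.Binary.PropositionalEquality using (_≡_)
open import Data.Product using (_×_)

-- k-th elementary symmetric polynomial, evaluated at a vector of naturals:
-- σ_0 = 1, σ_{k+1}() = 0, σ_{k+1}(x ∷ xs) = x * σ_k(xs) + σ_{k+1}(xs).
σ : ∀ {n} → ℕ → Vec ℕ n → ℕ
σ zero    _        = 1
σ (suc k) []       = 0
σ (suc k) (x ∷ xs) = x * σ k xs + σ (suc k) xs

InS : (n : ℕ) → Vec ℕ n → Set
InS n x =
  (∀ (j : Fin n) → 1 ≤ lookup x j) ×
  (∀ (j k : Fin n) → toℕ j ≤ toℕ k → lookup x j ≤ lookup x k) ×
  (σ 2 x ≡ σ n x)

InSᵢ : (n i : ℕ) → Vec ℕ n → Set
InSᵢ n i x =
  i ≤ n ×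
  InS n x ×
  (∀ (j : Fin n) → toℕ j < n ∸ i → lookup x j ≡ 1) ×
  (∀ (j : Fin n) → n ∸ i ≤ toℕ j → 2 ≤ lookup x j)

{-# OPTIONS --safe #-}
module Submission where

-- Call an entry large if it is at least 2, and let ℓ be the number of large
-- entries; a point of S_i(n) has ℓ ≥ i. A monomial of σₖ is σₙ divided by the
-- product of the other n − k entries, at least ℓ − k of which are large, so
-- 2^ℓ σₖ ≤ 2^k C(n,k) σₙ. For k = 2 the equation σ₂ = σₙ then forces
-- 2^i ≤ 2^ℓ ≤ 4 C(n,2).

open import Defs
open import Data.Nat using (ℕ; zero; suc; _+_; _*_; _∸_; _^_; _≤_; _<_; _≤?_; z≤n; s≤s; NonZero; >-nonZero)
open import Data.Nat.Properties
open import Data.Nat.Combinatorics using (_C_; nCk+nC[k+1]≡[n+1]C[k+1])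
open import Data.Nat.Logarithm using (⌊log₂_⌋; ⌊log₂[2*b]⌋≡1+⌊log₂b⌋; ⌊log₂[2^n]⌋≡n; ⌊log₂⌋-mono-≤)
open import Data.Nat.Tactic.RingSolver using (solve-∀)
open import Data.Vec using (Vec; []; _∷_; lookup; count)
open import Data.Fin using (Fin; toℕ) renaming (zero to fzero; suc to fsuc)
open import Data.Product using (∃; _,_)
open import Relation.Binary.PropositionalEquality using (_≡_; refl; sym; trans; cong; cong₂; subst; module ≡-Reasoning)
open import Relation.Nullary using (contradiction)

Positive : ∀ {n} → Vec ℕ n → Set
Positive {n} xs = ∀ (j : Fin n) → 1 ≤ lookup xs j

large : ∀ {n} → Vec ℕ n → ℕ
large = count (2 ≤?_)

n<k⇒σₖ≡0 : ∀ {n} k (xs : Vec ℕ n) → n < k → σ k xs ≡ 0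
n<k⇒σₖ≡0 (suc k) []       _         = refl
n<k⇒σₖ≡0 (suc k) (x ∷ xs) (s≤s n<k) =
  trans (cong₂ (λ a b → x * a + b) (n<k⇒σₖ≡0 k xs n<k) (n<k⇒σₖ≡0 (suc k) xs (m<n⇒m<1+n n<k)))
        (cong (_+ 0) (*-zeroʳ x))

σₙ₊₁-∷ : ∀ {n} x (xs : Vec ℕ n) → σ (suc n) (x ∷ xs) ≡ x * σ n xs
σₙ₊₁-∷ {n} x xs = trans (cong (x * σ n xs +_) (n<k⇒σₖ≡0 (suc n) xs ≤-refl)) (+-identityʳ _)

σₙ≢0 : ∀ {n} (xs : Vec ℕ n) → Positive xs → NonZero (σ n xs)
σₙ≢0 []       _   = _
σₙ≢0 (x ∷ xs) pos = subst NonZero (sym (σₙ₊₁-∷ x xs))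
  (m*n≢0 x _ {{>-nonZero (pos fzero)}} {{σₙ≢0 xs (λ j → pos (fsuc j))}})

large-∷-mono : ∀ {n} x (xs : Vec ℕ n) → large xs ≤ large (x ∷ xs)
large-∷-mono zero           _ = ≤-refl
large-∷-mono (suc zero)     _ = ≤-refl
large-∷-mono (suc (suc _))  _ = n≤1+n _

large-∷-≥2 : ∀ {n x} (xs : Vec ℕ n) → 2 ≤ x → large (x ∷ xs) ≡ suc (large xs)
large-∷-≥2 _ (s≤s (s≤s _)) = refl

2^large[x∷xs]≤2*2^large[xs] : ∀ {n} x (xs : Vec ℕ n) → 2 ^ large (x ∷ xs) ≤ 2 * 2 ^ large xs
2^large[x∷xs]≤2*2^large[xs] zero          xs = m≤n*m (2 ^ large xs) 2
2^large[x∷xs]≤2*2^large[xs] (suc zero)    xs = m≤n*m (2 ^ large xs) 2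
2^large[x∷xs]≤2*2^large[xs] (suc (suc _)) _  = ≤-refl

2^large[x∷xs]≤x*2^large[xs] : ∀ {n} x (xs : Vec ℕ n) → 1 ≤ x → 2 ^ large (x ∷ xs) ≤ x * 2 ^ large xs
2^large[x∷xs]≤x*2^large[xs] (suc zero)      xs _ = ≤-reflexive (sym (*-identityˡ _))
2^large[x∷xs]≤x*2^large[xs] x@(suc (suc _)) xs _ = *-monoˡ-≤ (2 ^ large xs) {2} {x} (s≤s (s≤s z≤n))

n∸m≤large : ∀ {n} (xs : Vec ℕ n) m → (∀ (j : Fin n) → m ≤ toℕ j → 2 ≤ lookup xs j) → n ∸ m ≤ large xs
n∸m≤large []       m       _     = ≤-reflexive (0∸n≡0 m)
n∸m≤large (x ∷ xs) zero    all≥2 = subst (_ ≤_) (sym (large-∷-≥2 xs (all≥2 fzero z≤n)))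
  (s≤s (n∸m≤large xs zero (λ j _ → all≥2 (fsuc j) z≤n)))
n∸m≤large (x ∷ xs) (suc m) tail≥2 =
  ≤-trans (n∸m≤large xs m (λ j m≤j → tail≥2 (fsuc j) (s≤s m≤j))) (large-∷-mono x xs)

2^large*σₖ≤2^k*nCk*σₙ : ∀ {n} k (xs : Vec ℕ n) → Positive xs →
  2 ^ large xs * σ k xs ≤ 2 ^ k * ((n C k) * σ n xs)
2^large*σₖ≤2^k*nCk*σₙ zero    []       _   = ≤-refl
2^large*σₖ≤2^k*nCk*σₙ (suc k) []       _   = z≤n
2^large*σₖ≤2^k*nCk*σₙ {suc n} zero (x ∷ xs) pos = begin
  2 ^ large (x ∷ xs) * 1          ≡⟨ *-identityʳ _ ⟩
  2 ^ large (x ∷ xs)              ≤⟨ 2^large[x∷xs]≤x*2^large[xs] x xs (pos fzero) ⟩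
  x * 2 ^ large xs                ≡⟨ cong (x *_) (sym (*-identityʳ _)) ⟩
  x * (2 ^ large xs * 1)          ≤⟨ *-monoʳ-≤ x (2^large*σₖ≤2^k*nCk*σₙ zero xs (λ j → pos (fsuc j))) ⟩
  x * (1 * (1 * σ n xs))          ≡⟨ shuffle x (σ n xs) ⟩
  1 * (1 * (x * σ n xs))          ≡⟨ cong (λ s → 1 * (1 * s)) (sym (σₙ₊₁-∷ x xs)) ⟩
  1 * (1 * σ (suc n) (x ∷ xs))    ∎
  where
  open ≤-Reasoning
  shuffle : ∀ x P → x * (1 * (1 * P)) ≡ 1 * (1 * (x * P))
  shuffle = solve-∀
-- The factor 2^large contributed by x is at most 2, absorbed by 2^(k+1), when
-- x multiplies a monomial of σₖ, and at most x, absorbed by σₙ₊₁ = x σₙ, otherwise.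
2^large*σₖ≤2^k*nCk*σₙ {suc n} (suc k) (x ∷ xs) pos = begin
  A * (x * σ k xs + σ (suc k) xs)
    ≡⟨ distrib A x (σ k xs) (σ (suc k) xs) ⟩
  x * (A * σ k xs) + A * σ (suc k) xs
    ≤⟨ +-mono-≤ (*-monoʳ-≤ x (*-monoˡ-≤ (σ k xs) (2^large[x∷xs]≤2*2^large[xs] x xs)))
                (*-monoˡ-≤ (σ (suc k) xs) (2^large[x∷xs]≤x*2^large[xs] x xs (pos fzero))) ⟩
  x * (2 * E * σ k xs) + x * E * σ (suc k) xs
    ≡⟨ cong₂ _+_ (cong (x *_) (*-assoc 2 E (σ k xs))) (*-assoc x E (σ (suc k) xs)) ⟩
  x * (2 * (E * σ k xs)) + x * (E * σ (suc k) xs)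
    ≤⟨ +-mono-≤ (*-monoʳ-≤ x (*-monoʳ-≤ 2 (2^large*σₖ≤2^k*nCk*σₙ k xs pos′)))
                (*-monoʳ-≤ x (2^large*σₖ≤2^k*nCk*σₙ (suc k) xs pos′)) ⟩
  x * (2 * (2 ^ k * ((n C k) * P))) + x * (2 ^ suc k * ((n C suc k) * P))
    ≡⟨ collect x (2 ^ k) (n C k) (n C suc k) P ⟩
  2 ^ suc k * ((n C k + n C suc k) * (x * P))
    ≡⟨ cong₂ (λ c s → 2 ^ suc k * (c * s)) (nCk+nC[k+1]≡[n+1]C[k+1] n k) (sym (σₙ₊₁-∷ x xs)) ⟩
  2 ^ suc k * ((suc n C suc k) * σ (suc n) (x ∷ xs)) ∎
  where
  open ≤-Reasoning
  A = 2 ^ large (x ∷ xs)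
  E = 2 ^ large xs
  P = σ n xs
  pos′ : Positive xs
  pos′ j = pos (fsuc j)
  distrib : ∀ A x s t → A * (x * s + t) ≡ x * (A * s) + A * t
  distrib = solve-∀
  collect : ∀ x p a b P → x * (2 * (p * (a * P))) + x * (2 * p * (b * P)) ≡ 2 * p * ((a + b) * (x * P))
  collect = solve-∀

⌊log₂[2^k*m]⌋≡k+⌊log₂m⌋ : ∀ k m .{{_ : NonZero m}} → ⌊log₂ (2 ^ k * m) ⌋ ≡ k + ⌊log₂ m ⌋
⌊log₂[2^k*m]⌋≡k+⌊log₂m⌋ zero    m = cong ⌊log₂_⌋ (*-identityˡ m)
⌊log₂[2^k*m]⌋≡k+⌊log₂m⌋ (suc k) m = begin
  ⌊log₂ (2 * 2 ^ k * m) ⌋   ≡⟨ cong ⌊log₂_⌋ (*-assoc 2 (2 ^ k) m) ⟩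
  ⌊log₂ (2 * (2 ^ k * m)) ⌋ ≡⟨ ⌊log₂[2*b]⌋≡1+⌊log₂b⌋ (2 ^ k * m) {{m*n≢0 (2 ^ k) m {{m^n≢0 2 k}}}} ⟩
  suc ⌊log₂ (2 ^ k * m) ⌋   ≡⟨ cong suc (⌊log₂[2^k*m]⌋≡k+⌊log₂m⌋ k m) ⟩
  suc (k + ⌊log₂ m ⌋)       ∎
  where open ≡-Reasoning

2^i≤2^k*m⇒i≤k+⌊log₂m⌋ : ∀ i k m → 2 ^ i ≤ 2 ^ k * m → i ≤ k + ⌊log₂ m ⌋
2^i≤2^k*m⇒i≤k+⌊log₂m⌋ i k zero    2^i≤0 = contradiction (subst (2 ^ i ≤_) (*-zeroʳ (2 ^ k)) 2^i≤0) (<⇒≱ (m^n>0 2 i))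
2^i≤2^k*m⇒i≤k+⌊log₂m⌋ i k m@(suc _) 2^i≤2^k*m = begin
  i                       ≡⟨ sym (⌊log₂[2^n]⌋≡n i) ⟩
  ⌊log₂ (2 ^ i) ⌋         ≤⟨ ⌊log₂⌋-mono-≤ 2^i≤2^k*m ⟩
  ⌊log₂ (2 ^ k * m) ⌋     ≡⟨ ⌊log₂[2^k*m]⌋≡k+⌊log₂m⌋ k m ⟩
  k + ⌊log₂ m ⌋           ∎
  where open ≤-Reasoning

lemma2p3 : (n i : ℕ) → 3 ≤ n → ∃ (λ (x : Vec ℕ n) → InSᵢ n i x) →
    i ≤ 2 + ⌊log₂ (n C 2) ⌋
lemma2p3 n i _ (x , i≤n , (pos , _ , σ₂≡σₙ) , _ , tail≥2) =
  2^i≤2^k*m⇒i≤k+⌊log₂m⌋ i 2 (n C 2) (≤-trans (^-monoʳ-≤ 2 i≤large) 2^large≤4*nC2)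
  where
  instance
    σₙ-nonZero : NonZero (σ n x)
    σₙ-nonZero = σₙ≢0 x pos
  i≤large : i ≤ large x
  i≤large = subst (_≤ large x) (m∸[m∸n]≡n i≤n) (n∸m≤large x (n ∸ i) tail≥2)
  2^large≤4*nC2 : 2 ^ large x ≤ 4 * (n C 2)
  2^large≤4*nC2 = *-cancelʳ-≤ (2 ^ large x) (4 * (n C 2)) (σ n x) (begin
    2 ^ large x * σ n x        ≡⟨ cong (2 ^ large x *_) (sym σ₂≡σₙ) ⟩
    2 ^ large x * σ 2 x        ≤⟨ 2^large*σₖ≤2^k*nCk*σₙ 2 x pos ⟩
    4 * ((n C 2) * σ n x)      ≡⟨ sym (*-assoc 4 (n C 2) (σ n x)) ⟩
    4 * (n C 2) * σ n x        ∎)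
    where open ≤-Reasoning
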